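{- Let $k\ge0$ and $\ell\ge 4k$ be integers, $T$ a string, and $T[a\mathinner{.\,.} b)$ a uniform $k$-run of period $\ell$ in $T$. Then $T[a\mathinner{.\,.} b)$ is induced by a generalised run with period $\ell$, or it is induced by some collection of $(2k+2)$-MGRs of period $\ell$ whose total weight is at least $\frac14$.
   Context: $T[i\mathinner{.\,.} j)=T[i]\cdots T[j-1]$, positions numbered from 1, $n=|T|$. A uniform $k$-run of period $\ell$ is a substring $T[a\mathinner{.\,.} b)$ with $b-a\ge 2\ell$ such that the sets $\{j\in[i\mathinner{.\,.} i+\ell): T[j]\ne T[j+\ell]\}$ for all $i\in[a\mathinner{.\,.} b-2\ell]$ have cardinality at most $k$ and are all equal. A gapped repeat is a fragment $T[x\mathinner{.\,.} y)=UVU$ with $|U|>0$; its period is $|UV|$, its weight is $|U|/|UV|$. For real $\alpha\ge1$ it is an $\alpha$-gapped repeat if $|UV|\le\alpha|U|$. It is maximal (MGR) if its arms cannot be extended simultaneously with the same character to the left or right, i.e., ($x=1$ or $T[x-1]\ne T[x-1+|UV|]$) and ($y=n+1$ or $T[y-|UV|]\ne T[y]$); an $\alpha$-MGR is a maximal $\alpha$-gapped repeat. A generalised run is a pair $(T[x\mathinner{.\,.} y),p)$ with $2p\le y-x$, $T[x\mathinner{.\,.} y)$ having period $p$, ($x=1$ or $T[x-1\mathinner{.\,.} y)$ not having period $p$) and ($y=n+1$ or $T[x\mathinner{.\,.} y]$ not having period $p$). An MGR $T[x\mathinner{.\,.} y)$ of period $\ell$, or a generalised run $(T[x\mathinner{.\,.}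 y),\ell)$, induces a uniform $k$-run $T[a\mathinner{.\,.} b)$ of period $\ell$ if $[x\mathinner{.\,.} y-\ell)\cap[a\mathinner{.\,.} b-\ell)\ne\emptyset$. -}

module Defs where

open import Data.Nat using (ℕ; zero; suc; _+_; _*_; _∸_; _≤_; _<_; _<?_; NonZero)
open import Data.Fin using (Fin; fromℕ<)
open import Data.Maybe using (Maybe; just; nothing)
open import Data.List using (List; []; _∷_; filter; length; upTo; map; foldr)
open import Data.List.Membership.Propositional using (_∈_)
open import Data.List.Relation.Unary.All using (All)
open import Data.List.Relation.Unary.Unique.Propositional using (Unique)
open import Data.Product using (_×_; ∃-syntax; _,_)
open import Data.Sum using (_⊎_)
open import Data.Integer using (+_)
open import Data.Rational using (ℚ; 0ℚ) renaming (_+_ to _+ℚ_; _/_ to _/ℚ_)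
open import Relation.Nullary using (¬_; ¬?; Dec; yes; no)
open import Relation.Binary.PropositionalEquality using (_≡_; _≢_)
open import Relation.Binary.Definitions using (DecidableEquality)
open import Data.Maybe.Properties using (≡-dec)
open import Function.Bundles using (_⇔_)

-- A string of length n over alphabet A is T : Fin n → A.
-- 1-based character access: T ⟦ i ⟧ = just T[i] for i ∈ [1 .. n], nothing otherwise.
-- (All definitions below only access positions inside [1 .. n].)
_⟦_⟧ : ∀ {A : Set} {n : ℕ} → (Fin n → A) → ℕ → Maybe A
_⟦_⟧ T zero = nothing
_⟦_⟧ {n = n} T (suc i) with i <? n
... | yes p = just (T (fromℕ< p))
... | no _  = nothing

range : ℕ → ℕ → List ℕ
range i m = map (λ t → i + t) (upTo m)

mismatches : ∀ {A : Set} {n : ℕ} → DecidableEquality A → (Fin n → A) → ℕ → ℕ → List ℕ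
mismatches _≟_ T ℓ i = filter (λ j → ¬? (≡-dec _≟_ (T ⟦ j ⟧) (T ⟦ j + ℓ ⟧))) (range i ℓ)

UniformRun : ∀ {A : Set} {n : ℕ} → DecidableEquality A → (Fin n → A) →
             (k ℓ a b : ℕ) → Set
UniformRun {n = n} dec T k ℓ a b =
  1 ≤ a × b ≤ suc n × a + 2 * ℓ ≤ b
  × (∀ i → a ≤ i → i + 2 * ℓ ≤ b → length (mismatches dec T ℓ i) ≤ k)
  × (∀ i i′ → a ≤ i → i + 2 * ℓ ≤ b → a ≤ i′ → i′ + 2 * ℓ ≤ b →
       ∀ j → (j ∈ mismatches dec T ℓ i) ⇔ (j ∈ mismatches dec T ℓ i′))

HasPeriod : ∀ {A : Set} {n : ℕ} → (Fin n → A) → (x y p : ℕ) → Set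
HasPeriod T x y p = ∀ i → x ≤ i → i + p < y → T ⟦ i ⟧ ≡ T ⟦ i + p ⟧

-- T[x .. y) = UVU is a gapped repeat of period ℓ = |UV|, with |U| = y - x - ℓ > 0
-- and |V| = ℓ - |U| ≥ 0.
GappedRepeat : ∀ {A : Set} {n : ℕ} → (Fin n → A) → (ℓ x y : ℕ) → Set
GappedRepeat {n = n} T ℓ x y =
  1 ≤ x × y ≤ suc n × x + ℓ < y × y ≤ x + 2 * ℓ × HasPeriod T x y ℓ

armLength : (ℓ x y : ℕ) → ℕ
armLength ℓ x y = y ∸ x ∸ ℓ

AlphaGapped : (α ℓ x y : ℕ) → Set
AlphaGapped α ℓ x y = ℓ ≤ α * armLength ℓ x y

Maximal : ∀ {A : Set} {n : ℕ} → (Fin n → A) → (ℓ x y : ℕ) → Set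
Maximal {n = n} T ℓ x y =
  (x ≡ 1 ⊎ T ⟦ x ∸ 1 ⟧ ≢ T ⟦ x ∸ 1 + ℓ ⟧)
  × (y ≡ suc n ⊎ T ⟦ y ∸ ℓ ⟧ ≢ T ⟦ y ⟧)

MGR : ∀ {A : Set} {n : ℕ} → (Fin n → A) → (α ℓ x y : ℕ) → Set
MGR T α ℓ x y = GappedRepeat T ℓ x y × AlphaGapped α ℓ x y × Maximal T ℓ x y

GenRun : ∀ {A : Set} {n : ℕ} → (Fin n → A) → (x y p : ℕ) → Set
GenRun {n = n} T x y p =
  1 ≤ x × y ≤ suc n × x + 2 * p ≤ y × HasPeriod T x y p
  × (x ≡ 1 ⊎ ¬ HasPeriod T (x ∸ 1) y p)
  × (y ≡ suc n ⊎ ¬ HasPeriod T x (suc y) p)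

Induces : (x y ℓ a b : ℕ) → Set
Induces x y ℓ a b = ∃[ i ] (x ≤ i × i + ℓ < y × a ≤ i × i + ℓ < b)

weight : (ℓ x y : ℕ) → .{{NonZero ℓ}} → ℚ
weight ℓ x y = (+ armLength ℓ x y) /ℚ ℓ

totalWeight : (ℓ : ℕ) → .{{NonZero ℓ}} → List (ℕ × ℕ) → ℚ
totalWeight ℓ [] = 0ℚ
totalWeight ℓ ((x , y) ∷ rs) = weight ℓ x y +ℚ totalWeight ℓ rs

{-# OPTIONS --safe #-}
-- Let c = b − ℓ. The uniform run forces every position i ∈ [a, c) with T[i] ≠ T[i + ℓ]
-- into the first window [a, a + ℓ), so there are at most k of them. They cut [a, c), of
-- length at least ℓ, into at most k + 1 blocks of positions with T[i] = T[i + ℓ]. Extended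
-- maximally, a block [s, e) is the fragment T[s .. e + ℓ) of period ℓ: a generalised run if
-- e − s ≥ ℓ, and a (2k+2)-MGR of weight (e − s)/ℓ if (2k + 2)(e − s) ≥ ℓ. If no block is a
-- generalised run, the blocks too light to be (2k+2)-MGRs cover less than
-- (k + 1) ℓ / (2k + 2) = ℓ/2 of [a, c) and the mismatches at most k ≤ ℓ/4, so the MGRs
-- cover at least ℓ/4: their total weight is at least 1/4.

module Submission where

open import Defs
open import Data.Nat
  using (ℕ; zero; suc; _+_; _*_; _∸_; _⊔_; _≤_; _<_; z≤n; s≤s; z<s; _≤?_; _<?_;
         NonZero; >-nonZero⁻¹)
open import Data.Nat.Properties hiding (_≟_)
open import Data.Nat.Tactic.RingSolver using (solve-∀)
open import Data.Fin using (Fin)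
open import Data.List using (List; []; _∷_; filter; length; map; upTo; applyUpTo)
open import Data.List.Properties using (filter-accept; filter-reject; map-upTo; map-∘; map-cong)
open import Data.List.Membership.Propositional using (_∈_)
open import Data.List.Membership.Propositional.Properties
  using (∈-map⁺; ∈-map⁻; ∈-upTo⁺; ∈-upTo⁻; ∈-filter⁺; ∈-filter⁻)
open import Data.List.Relation.Unary.All as All using (All; []; _∷_)
open import Data.List.Relation.Unary.AllPairs using ([]; _∷_)
open import Data.List.Relation.Unary.Unique.Propositional using (Unique)
open import Data.Product using (_×_; ∃-syntax; _,_; proj₁; proj₂)
open import Data.Sum using (_⊎_; inj₁; inj₂; map₂)
open import Data.Integer as ℤ using (+_)
import Data.Integer.Properties as ℤ
open import Data.Rational using (_/_; toℚᵘ) renaming (_≤_ to _≤ℚ_)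
import Data.Rational.Properties as ℚ
open import Data.Rational.Unnormalised as ℚᵘ using (mkℚᵘ; *≡*; *≤*) renaming (_≃_ to _≃ᵘ_)
import Data.Rational.Unnormalised.Properties as ℚᵘ
open import Data.Maybe.Properties using (≡-dec)
open import Function.Bundles using (Equivalence)
open import Relation.Nullary using (¬_; ¬?; yes; no; contradiction)
open import Relation.Nullary.Decidable using (decidable-stable)
open import Relation.Unary using (Decidable)
open import Relation.Binary.Definitions using (DecidableEquality)
open import Relation.Binary.PropositionalEquality
  using (_≡_; _≢_; refl; sym; trans; cong; cong₂; subst; subst₂; module ≡-Reasoning)

range-suc : ∀ i m → range i (suc m) ≡ i ∷ range (suc i) m
range-suc i m = cong₂ _∷_ (+-identityʳ i) (begin
  map (λ t → i + t) (applyUpTo suc m)   ≡⟨ cong (map (λ t → i + t)) (map-upTo suc m) ⟨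
  map (λ t → i + t) (map suc (upTo m))  ≡⟨ map-∘ (upTo m) ⟨
  map (λ t → i + suc t) (upTo m)        ≡⟨ map-cong (+-suc i) (upTo m) ⟩
  range (suc i) m                       ∎)
  where open ≡-Reasoning

∈-range⁺ : ∀ {i j m} → i ≤ j → j < i + m → j ∈ range i m
∈-range⁺ {i} {j} {m} i≤j j<i+m = subst (_∈ range i m) (m+[n∸m]≡n i≤j)
  (∈-map⁺ (λ t → i + t) (∈-upTo⁺ j∸i<m))
  where
  j∸i<m : j ∸ i < m
  j∸i<m = subst (j ∸ i <_) (m+n∸m≡n i m) (∸-monoˡ-< j<i+m i≤j)

∈-range⁻ : ∀ {i j m} → j ∈ range i m → i ≤ j × j < i + m
∈-range⁻ {i} p with t , t<m , refl ← ∈-map⁻ (λ t → i + t) p =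
  m≤m+n i t , +-monoʳ-< i (∈-upTo⁻ t<m)

+-2* : ∀ m n → m + 2 * n ≡ m + n + n
+-2* = solve-∀

armLength-+ : ∀ ℓ s e → armLength ℓ s (e + ℓ) ≡ e ∸ s
armLength-+ ℓ s e = begin
  e + ℓ ∸ s ∸ ℓ    ≡⟨ ∸-+-assoc (e + ℓ) s ℓ ⟩
  e + ℓ ∸ (s + ℓ)  ≡⟨ cong₂ _∸_ (+-comm e ℓ) (+-comm s ℓ) ⟩
  ℓ + e ∸ (ℓ + s)  ≡⟨ [m+n]∸[m+o]≡n∸o ℓ e s ⟩
  e ∸ s            ∎
  where open ≡-Reasoning

-- Cancelling k + 1 leaves ℓ ≤ 2W + 2k, and 2k ≤ ℓ/2.
ℓ≤4W-from-budget : ∀ {k ℓ a W} → 4 * k ≤ ℓ →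
                    (2 * k + 2) * (a + ℓ) ≤ (2 * k + 2) * (a + W + k) + suc k * ℓ → ℓ ≤ 4 * W
ℓ≤4W-from-budget {k} {ℓ} {a} {W} 4k≤ℓ budget = +-cancelˡ-≤ (4 * a + 3 * ℓ) ℓ (4 * W) (begin
  4 * a + 3 * ℓ + ℓ              ≡⟨ e₁ a ℓ ⟩
  2 * (2 * (a + ℓ))              ≤⟨ *-monoʳ-≤ 2 halved ⟩
  2 * (2 * (a + W + k) + ℓ)      ≡⟨ e₂ a W k ℓ ⟩
  4 * a + 2 * ℓ + 4 * W + 4 * k  ≤⟨ +-monoʳ-≤ (4 * a + 2 * ℓ + 4 * W) 4k≤ℓ ⟩
  4 * a + 2 * ℓ + 4 * W + ℓ      ≡⟨ e₃ a ℓ W ⟩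
  4 * a + 3 * ℓ + 4 * W          ∎)
  where
  open ≤-Reasoning
  e₁ : ∀ a ℓ → 4 * a + 3 * ℓ + ℓ ≡ 2 * (2 * (a + ℓ))
  e₁ = solve-∀
  e₂ : ∀ a W k ℓ → 2 * (2 * (a + W + k) + ℓ) ≡ 4 * a + 2 * ℓ + 4 * W + 4 * k
  e₂ = solve-∀
  e₃ : ∀ a ℓ W → 4 * a + 2 * ℓ + 4 * W + ℓ ≡ 4 * a + 3 * ℓ + 4 * W
  e₃ = solve-∀
  e₄ : ∀ k a ℓ → (2 * k + 2) * (a + ℓ) ≡ suc k * (2 * (a + ℓ))
  e₄ = solve-∀
  e₅ : ∀ k a W ℓ → (2 * k + 2) * (a + W + k) + suc k * ℓ ≡ suc k * (2 * (a + W + k) + ℓ)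
  e₅ = solve-∀
  halved : 2 * (a + ℓ) ≤ 2 * (a + W + k) + ℓ
  halved = *-cancelˡ-≤ (suc k) (subst₂ _≤_ (e₄ k a ℓ) (e₅ k a W ℓ) budget)

armSum : ℕ → List (ℕ × ℕ) → ℕ
armSum ℓ [] = 0
armSum ℓ ((x , y) ∷ rs) = armLength ℓ x y + armSum ℓ rs

mkℚᵘ-+-sameDenominator : ∀ p q d →
                         mkℚᵘ (+ p) d ℚᵘ.+ mkℚᵘ (+ q) d ≃ᵘ mkℚᵘ (+ (p + q)) d
mkℚᵘ-+-sameDenominator p q d = *≡* (begin
  (+ p ℤ.* + suc d ℤ.+ + q ℤ.* + suc d) ℤ.* + suc d
    ≡⟨ cong (ℤ._* + suc d) (ℤ.*-distribʳ-+ (+ suc d) (+ p) (+ q)) ⟨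
  (+ p ℤ.+ + q) ℤ.* + suc d ℤ.* + suc d
    ≡⟨ ℤ.*-assoc (+ p ℤ.+ + q) (+ suc d) (+ suc d) ⟩
  (+ p ℤ.+ + q) ℤ.* (+ suc d ℤ.* + suc d)
    ≡⟨ cong₂ ℤ._*_ (ℤ.pos-+ p q) (ℤ.pos-* (suc d) (suc d)) ⟨
  + (p + q) ℤ.* + (suc d * suc d)
    ∎)
  where open ≡-Reasoning

toℚᵘ-totalWeight : ∀ d rs → toℚᵘ (totalWeight (suc d) rs) ≃ᵘ mkℚᵘ (+ armSum (suc d) rs) d
toℚᵘ-totalWeight d [] = *≡* refl
toℚᵘ-totalWeight d ((x , y) ∷ rs) = begin
  toℚᵘ (weight (suc d) x y Data.Rational.+ totalWeight (suc d) rs)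
    ≈⟨ ℚ.toℚᵘ-homo-+ (weight (suc d) x y) (totalWeight (suc d) rs) ⟩
  toℚᵘ (weight (suc d) x y) ℚᵘ.+ toℚᵘ (totalWeight (suc d) rs)
    ≈⟨ ℚᵘ.+-cong (ℚ.toℚᵘ-fromℚᵘ (mkℚᵘ (+ armLength (suc d) x y) d))
                 (toℚᵘ-totalWeight d rs) ⟩
  mkℚᵘ (+ armLength (suc d) x y) d ℚᵘ.+ mkℚᵘ (+ armSum (suc d) rs) d
    ≈⟨ mkℚᵘ-+-sameDenominator (armLength (suc d) x y) (armSum (suc d) rs) d ⟩
  mkℚᵘ (+ armSum (suc d) ((x , y) ∷ rs)) d
    ∎
  where open ℚᵘ.≃-Reasoning

quarter≤totalWeight : ∀ ℓ .{{_ : NonZero ℓ}} rs → ℓ ≤ 4 * armSum ℓ rs →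
                      (+ 1) / 4 ≤ℚ totalWeight ℓ rs
quarter≤totalWeight (suc d) rs ℓ≤4W = ℚ.toℚᵘ-cancel-≤
  (ℚᵘ.≤-respʳ-≃ (ℚᵘ.≃-sym (toℚᵘ-totalWeight d rs))
    (*≤* (subst (+ (1 * suc d) ℤ.≤_) (ℤ.pos-* W 4)
      (ℤ.+≤+ (subst₂ _≤_ (sym (*-identityˡ (suc d))) (*-comm 4 W) ℓ≤4W)))))
  where
  W : ℕ
  W = armSum (suc d) rs

module Blocks {A : Set} (_≟_ : DecidableEquality A) {n : ℕ} (T : Fin n → A) (ℓ : ℕ) where

  Matches : ℕ → Set
  Matches j = T ⟦ j ⟧ ≡ T ⟦ j + ℓ ⟧

  matches? : Decidable Matches
  matches? j = ≡-dec _≟_ (T ⟦ j ⟧) (T ⟦ j + ℓ ⟧)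

  mismatch? : Decidable (λ j → ¬ Matches j)
  mismatch? j = ¬? (matches? j)

  mismatchCount : ℕ → ℕ → ℕ
  mismatchCount j r = length (filter mismatch? (range j r))

  mismatchCount-match : ∀ {j} r → Matches j → mismatchCount j (suc r) ≡ mismatchCount (suc j) r
  mismatchCount-match {j} r m = trans (cong (λ xs → length (filter mismatch? xs)) (range-suc j r))
    (cong length (filter-reject mismatch? {j} {range (suc j) r} (λ ¬m → ¬m m)))

  mismatchCount-mismatch : ∀ {j} r → ¬ Matches j →
                           mismatchCount j (suc r) ≡ suc (mismatchCount (suc j) r)
  mismatchCount-mismatch {j} r ¬m = trans (cong (λ xs → length (filter mismatch? xs)) (range-suc j r))
    (cong length (filter-accept mismatch? {j} {range (suc j) r} ¬m))

  MatchesOn : ℕ → ℕ → Set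
  MatchesOn s e = ∀ i → s ≤ i → i < e → Matches i

  matchesOn-∅ : ∀ j → MatchesOn j j
  matchesOn-∅ j i j≤i i<j = contradiction i<j (≤⇒≯ j≤i)

  matchesOn-singleton : ∀ {j} → Matches j → MatchesOn j (suc j)
  matchesOn-singleton m i j≤i i<1+j = subst Matches (≤-antisym j≤i (≤-pred i<1+j)) m

  matchesOn-++ : ∀ {s j e} → MatchesOn s j → MatchesOn j e → MatchesOn s e
  matchesOn-++ {j = j} on₁ on₂ i s≤i i<e with i <? j
  ... | yes i<j = on₁ i s≤i i<j
  ... | no i≮j  = on₂ i (≮⇒≥ i≮j) i<e

  matchesOn⇒hasPeriod : ∀ {s e} → MatchesOn s e → HasPeriod T s (e + ℓ) ℓ
  matchesOn⇒hasPeriod {e = e} on i s≤i i+ℓ<e+ℓ = on i s≤i (+-cancelʳ-< ℓ i e i+ℓ<e+ℓ)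

  LeftMaximal : ℕ → Set
  LeftMaximal s = s ≡ 1 ⊎ ¬ Matches (s ∸ 1)

  RightMaximal : ℕ → Set
  RightMaximal e = e + ℓ ≡ suc n ⊎ ¬ Matches e

  -- The block [s, e) stands for the fragment T[s .. e + ℓ) of period ℓ.
  record LeftMaximalBlock (s e : ℕ) : Set where
    field
      1≤start     : 1 ≤ s
      start≤end   : s ≤ e
      matchesOn   : MatchesOn s e
      leftMaximal : LeftMaximal s

  record MaximalBlock (s e : ℕ) : Set where
    constructor maximalBlock
    field
      block        : LeftMaximalBlock s e
      end+ℓ≤1+n    : e + ℓ ≤ suc n
      rightMaximal : RightMaximal e
    open LeftMaximalBlock block public

  extendBlock : ∀ {s j e} → LeftMaximalBlock s j → j ≤ e → MatchesOn j e → LeftMaximalBlock s e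
  extendBlock blk j≤e on = record
    { 1≤start     = 1≤start
    ; start≤end   = ≤-trans start≤end j≤e
    ; matchesOn   = matchesOn-++ matchesOn on
    ; leftMaximal = leftMaximal
    }
    where open LeftMaximalBlock blk

  startAfterMismatch : ∀ {j} → ¬ Matches j → LeftMaximalBlock (suc j) (suc j)
  startAfterMismatch {j} ¬m = record
    { 1≤start = s≤s z≤n ; start≤end = ≤-refl ; matchesOn = matchesOn-∅ (suc j)
    ; leftMaximal = inj₂ ¬m }

  leftMaximalStart : ∀ j → 1 ≤ j → ∃[ s ] LeftMaximalBlock s j
  leftMaximalStart zero ()
  leftMaximalStart (suc zero) _ = 1 , record
    { 1≤start = ≤-refl ; start≤end = ≤-refl ; matchesOn = matchesOn-∅ 1
    ; leftMaximal = inj₁ refl }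
  leftMaximalStart (suc (suc j)) _ with matches? (suc j) | leftMaximalStart (suc j) (s≤s z≤n)
  ... | no ¬m | _       = suc (suc j) , startAfterMismatch ¬m
  ... | yes m | s , blk = s , extendBlock blk (n≤1+n (suc j)) (matchesOn-singleton m)

  rightMaximalEnd : ∀ {s j} → LeftMaximalBlock s j → j + ℓ ≤ suc n →
                    ∃[ e ] (j ≤ e × MaximalBlock s e)
  rightMaximalEnd {j = j} blk j+ℓ≤1+n = go (suc n ∸ (j + ℓ)) blk (m+[n∸m]≡n j+ℓ≤1+n)
    where
    go : ∀ r {s j} → LeftMaximalBlock s j → j + ℓ + r ≡ suc n →
         ∃[ e ] (j ≤ e × MaximalBlock s e)
    go zero {j = j} blk eq = j , ≤-refl , maximalBlock blk (≤-reflexive j+ℓ≡1+n) (inj₁ j+ℓ≡1+n)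
      where
      j+ℓ≡1+n : j + ℓ ≡ suc n
      j+ℓ≡1+n = trans (sym (+-identityʳ (j + ℓ))) eq
    go (suc r) {j = j} blk eq with matches? j
    ... | no ¬m = j , ≤-refl ,
                  maximalBlock blk (≤-trans (m≤m+n (j + ℓ) (suc r)) (≤-reflexive eq)) (inj₂ ¬m)
    ... | yes m = let e , j<e , mblk = go r (extendBlock blk (n≤1+n j) (matchesOn-singleton m))
                                         (trans (sym (+-suc (j + ℓ) r)) eq)
                  in e , <⇒≤ j<e , mblk

  maximalBlock⇒genRun : ∀ {s e} → MaximalBlock s e → ℓ ≤ e ∸ s → GenRun T s (e + ℓ) ℓ
  maximalBlock⇒genRun {s} {e} blk ℓ≤e∸s =
    1≤start , end+ℓ≤1+n , s+2ℓ≤e+ℓ , matchesOn⇒hasPeriod matchesOn ,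
    map₂ (λ ¬m p → ¬m (p (s ∸ 1) ≤-refl (+-monoˡ-< ℓ s∸1<e))) leftMaximal ,
    map₂ (λ ¬m p → ¬m (p e start≤end (n<1+n (e + ℓ)))) rightMaximal
    where
    open MaximalBlock blk
    s∸1<e : s ∸ 1 < e
    s∸1<e = <-≤-trans (∸-monoʳ-< z<s 1≤start) start≤end
    s+2ℓ≤e+ℓ : s + 2 * ℓ ≤ e + ℓ
    s+2ℓ≤e+ℓ = subst (_≤ e + ℓ) (sym (+-2* s ℓ))
      (+-monoˡ-≤ ℓ (subst (s + ℓ ≤_) (m+[n∸m]≡n start≤end) (+-monoʳ-≤ s ℓ≤e∸s)))

  maximalBlock⇒MGR : ∀ {α s e} → MaximalBlock s e → s < e → e ∸ s ≤ ℓ → ℓ ≤ α * (e ∸ s) →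
                     MGR T α ℓ s (e + ℓ)
  maximalBlock⇒MGR {α} {s} {e} blk s<e e∸s≤ℓ ℓ≤α[e∸s] =
    (1≤start , end+ℓ≤1+n , +-monoˡ-< ℓ s<e , e+ℓ≤s+2ℓ , matchesOn⇒hasPeriod matchesOn) ,
    subst (λ x → ℓ ≤ α * x) (sym (armLength-+ ℓ s e)) ℓ≤α[e∸s] ,
    leftMaximal ,
    map₂ (subst (λ x → T ⟦ x ⟧ ≢ T ⟦ e + ℓ ⟧) (sym (m+n∸n≡m e ℓ))) rightMaximal
    where
    open MaximalBlock blk
    e+ℓ≤s+2ℓ : e + ℓ ≤ s + 2 * ℓ
    e+ℓ≤s+2ℓ = subst (e + ℓ ≤_) (sym (+-2* s ℓ))
      (+-monoˡ-≤ ℓ (subst (_≤ s + ℓ) (m+[n∸m]≡n start≤end) (+-monoʳ-≤ s e∸s≤ℓ)))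

module UniformRunScan {A : Set} (_≟_ : DecidableEquality A) {n : ℕ} (T : Fin n → A)
                      {k ℓ : ℕ} .{{_ : NonZero ℓ}} (4k≤ℓ : 4 * k ≤ ℓ) {a b : ℕ}
                      (run : UniformRun _≟_ T k ℓ a b) where

  open Blocks _≟_ T ℓ

  K : ℕ
  K = 2 * k + 2

  c : ℕ
  c = b ∸ ℓ

  b≤1+n : b ≤ suc n
  b≤1+n = proj₁ (proj₂ run)

  a+2ℓ≤b : a + 2 * ℓ ≤ b
  a+2ℓ≤b = proj₁ (proj₂ (proj₂ run))

  a+ℓ+ℓ≤b : a + ℓ + ℓ ≤ b
  a+ℓ+ℓ≤b = subst (_≤ b) (+-2* a ℓ) a+2ℓ≤b

  c+ℓ≡b : c + ℓ ≡ b
  c+ℓ≡b = m∸n+n≡m (≤-trans (m≤n+m ℓ (a + ℓ)) a+ℓ+ℓ≤b)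

  a+ℓ≤c : a + ℓ ≤ c
  a+ℓ≤c = m+n≤o⇒m≤o∸n (a + ℓ) a+ℓ+ℓ≤b

  ≤c⇒+ℓ≤1+n : ∀ {j} → j ≤ c → j + ℓ ≤ suc n
  ≤c⇒+ℓ≤1+n j≤c = ≤-trans (+-monoˡ-≤ ℓ j≤c) (subst (_≤ suc n) (sym c+ℓ≡b) b≤1+n)

  mismatch<a+ℓ : ∀ {i j} → a ≤ i → i + 2 * ℓ ≤ b → j ∈ mismatches _≟_ T ℓ i → j < a + ℓ
  mismatch<a+ℓ {i} {j} a≤i i+2ℓ≤b j∈mᵢ =
    proj₂ (∈-range⁻ {a} {j} {ℓ} (proj₁ (∈-filter⁻ mismatch? {xs = range a ℓ} j∈mₐ)))
    where
    j∈mₐ : j ∈ mismatches _≟_ T ℓ a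
    j∈mₐ = Equivalence.to (proj₂ (proj₂ (proj₂ (proj₂ run))) i a a≤i i+2ℓ≤b ≤-refl a+2ℓ≤b j) j∈mᵢ

  matchesOn-beyondFirstWindow : MatchesOn (a + ℓ) c
  matchesOn-beyondFirstWindow j a+ℓ≤j j<c = decidable-stable (matches? j) λ ¬m →
    <⇒≱ (mismatch<a+ℓ a≤i i+2ℓ≤b (∈-filter⁺ mismatch? j∈window ¬m)) a+ℓ≤j
    where
    open ≤-Reasoning
    -- j is the last position of the window starting at i
    i : ℕ
    i = suc (j ∸ ℓ)
    ℓ≤j : ℓ ≤ j
    ℓ≤j = ≤-trans (m≤n+m ℓ a) a+ℓ≤j
    i+ℓ≡1+j : i + ℓ ≡ suc j
    i+ℓ≡1+j = cong suc (m∸n+n≡m ℓ≤j)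
    a≤i : a ≤ i
    a≤i = m≤n⇒m≤1+n (m+n≤o⇒m≤o∸n a a+ℓ≤j)
    i+2ℓ≤b : i + 2 * ℓ ≤ b
    i+2ℓ≤b = begin
      i + 2 * ℓ  ≡⟨ +-2* i ℓ ⟩
      i + ℓ + ℓ  ≡⟨ cong (_+ ℓ) i+ℓ≡1+j ⟩
      suc j + ℓ  ≤⟨ +-monoˡ-≤ ℓ j<c ⟩
      c + ℓ      ≡⟨ c+ℓ≡b ⟩
      b          ∎
    j∈window : j ∈ range i ℓ
    j∈window = ∈-range⁺ (∸-monoʳ-< (>-nonZero⁻¹ ℓ) ℓ≤j) (subst (j <_) (sym i+ℓ≡1+j) ≤-refl)

  InducedMGR : ℕ × ℕ → Set
  InducedMGR r = MGR T K ℓ (proj₁ r) (proj₂ r) × Induces (proj₁ r) (proj₂ r) ℓ a b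

  Conclusion : Set
  Conclusion = (∃[ x ] ∃[ y ] (GenRun T x y ℓ × Induces x y ℓ a b))
             ⊎ (∃[ rs ] (Unique rs × All InducedMGR rs × ((+ 1) / 4) ≤ℚ totalWeight ℓ rs))

  budget : (W t u : ℕ) → ℕ
  budget W t u = K * (a + W + t) + u * ℓ

  K*a≤budget : ∀ W t u → K * a ≤ budget W t u
  K*a≤budget W t u =
    ≤-trans (*-monoʳ-≤ K (≤-trans (m≤m+n a W) (m≤m+n (a + W) t))) (m≤m+n _ (u * ℓ))

  budget-+ℓ : ∀ W t u → budget W t u + ℓ ≡ budget W t (suc u)
  budget-+ℓ W t u =
    trans (+-assoc (K * (a + W + t)) (u * ℓ) ℓ)
          (cong (λ v → K * (a + W + t) + v) (+-comm (u * ℓ) ℓ))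

  budget-+K : ∀ W t u → K + budget W t u ≡ budget W (suc t) u
  budget-+K W t u = e K a W t (u * ℓ)
    where
    e : ∀ K a W t v → K + (K * (a + W + t) + v) ≡ K * (a + W + suc t) + v
    e = solve-∀

  budget-+arm : ∀ x W t u → budget W t u + K * x ≡ budget (x + W) t u
  budget-+arm x W t u = e K a W t (u * ℓ) x
    where
    e : ∀ K a W t v x → K * (a + W + t) + v + K * x ≡ K * (a + (x + W) + t) + v
    e = solve-∀

  -- Invariant of the scan: the part [a .. f) of [a .. c) is paid for by the arms of the collected
  -- MGRs, by t mismatches (one position each) and by u discarded blocks (less than ℓ / K each).
  record Collected (s f t u : ℕ) : Set where
    field
      mgrs         : List (ℕ × ℕ)
      unique       : Unique mgrs
      induced      : All InducedMGR mgrs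
      startBefore  : All (λ r → proj₁ r < s) mgrs
      withinBudget : K * f ≤ budget (armSum ℓ mgrs) t u

  nothingCollected : ∀ {s} → s ≤ a → Collected s s 0 0
  nothingCollected s≤a = record
    { mgrs = [] ; unique = [] ; induced = [] ; startBefore = []
    ; withinBudget = ≤-trans (*-monoʳ-≤ K s≤a) (K*a≤budget 0 0 0) }

  discard : ∀ {s e f t} → s ≤ e → K * f ≤ K * (s ⊔ a) + ℓ → Collected s s t t →
            Collected (suc e) f t (suc t)
  discard {s} {e} {f} {t} s≤e K*f≤ col = record
    { mgrs = mgrs ; unique = unique ; induced = induced
    ; startBefore = All.map (λ r<s → ≤-trans r<s (m≤n⇒m≤1+n s≤e)) startBefore
    ; withinBudget = begin
        K * f              ≤⟨ K*f≤ ⟩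
        K * (s ⊔ a) + ℓ    ≡⟨ cong (_+ ℓ) (*-distribˡ-⊔ K s a) ⟩
        K * s ⊔ K * a + ℓ  ≤⟨ +-monoˡ-≤ ℓ (⊔-lub withinBudget (K*a≤budget W t t)) ⟩
        budget W t t + ℓ   ≡⟨ budget-+ℓ W t t ⟩
        budget W t (suc t) ∎
    }
    where
    open Collected col
    open ≤-Reasoning
    W : ℕ
    W = armSum ℓ mgrs

  collect : ∀ {s e f t} → InducedMGR (s , e + ℓ) → s ≤ e → f ≤ e → Collected s s t t →
            Collected (suc e) f t (suc t)
  collect {s} {e} {f} {t} new s≤e f≤e col = record
    { mgrs = (s , e + ℓ) ∷ mgrs
    ; unique = All.map (λ r<s eq → <-irrefl (sym (cong proj₁ eq)) r<s) startBefore ∷ unique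
    ; induced = new ∷ induced
    ; startBefore = s≤s s≤e ∷ All.map (λ r<s → ≤-trans r<s (m≤n⇒m≤1+n s≤e)) startBefore
    ; withinBudget = begin
        K * f                                          ≤⟨ *-monoʳ-≤ K f≤e ⟩
        K * e                                          ≡⟨ cong (K *_) (m+[n∸m]≡n s≤e) ⟨
        K * (s + (e ∸ s))                              ≡⟨ *-distribˡ-+ K s (e ∸ s) ⟩
        K * s + K * (e ∸ s)                            ≤⟨ +-monoˡ-≤ (K * (e ∸ s)) withinBudget ⟩
        budget W t t + K * (e ∸ s)                     ≡⟨ budget-+arm (e ∸ s) W t t ⟩
        budget (e ∸ s + W) t t                         ≤⟨ m≤m+n _ ℓ ⟩
        budget (e ∸ s + W) t t + ℓ                     ≡⟨ budget-+ℓ (e ∸ s + W) t t ⟩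
        budget (e ∸ s + W) t (suc t)
          ≡⟨ cong (λ x → budget (x + W) t (suc t)) (armLength-+ ℓ s e) ⟨
        budget (armLength ℓ s (e + ℓ) + W) t (suc t)   ∎
    }
    where
    open Collected col
    open ≤-Reasoning
    W : ℕ
    W = armSum ℓ mgrs

  passMismatch : ∀ {j t} → Collected (suc j) j t (suc t) →
                 Collected (suc j) (suc j) (suc t) (suc t)
  passMismatch {j} {t} col = record
    { mgrs = mgrs ; unique = unique ; induced = induced ; startBefore = startBefore
    ; withinBudget = begin
        K * suc j                              ≡⟨ *-suc K j ⟩
        K + K * j                              ≤⟨ +-monoʳ-≤ K withinBudget ⟩
        K + budget (armSum ℓ mgrs) t (suc t)   ≡⟨ budget-+K (armSum ℓ mgrs) t (suc t) ⟩
        budget (armSum ℓ mgrs) (suc t) (suc t) ∎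
    }
    where
    open Collected col
    open ≤-Reasoning

  enoughArms : ∀ {W t} → t ≤ k → K * c ≤ budget W t (suc t) → ℓ ≤ 4 * W
  enoughArms {W} {t} t≤k within = ℓ≤4W-from-budget {k} {ℓ} {a} {W} 4k≤ℓ (begin
    K * (a + ℓ)         ≤⟨ *-monoʳ-≤ K a+ℓ≤c ⟩
    K * c               ≤⟨ within ⟩
    budget W t (suc t)  ≤⟨ +-mono-≤ (*-monoʳ-≤ K (+-monoʳ-≤ (a + W) t≤k))
                                   (*-monoˡ-≤ ℓ (s≤s t≤k)) ⟩
    budget W k (suc k)  ∎)
    where open ≤-Reasoning

  meets⇒induces : ∀ {s e f} → s ⊔ a < f → f ≤ e → f ≤ c → Induces s (e + ℓ) ℓ a b
  meets⇒induces {s} s⊔a<f f≤e f≤c =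
    s ⊔ a , m≤m⊔n s a , +-monoˡ-< ℓ (<-≤-trans s⊔a<f f≤e) , m≤n⊔m s a ,
    subst (s ⊔ a + ℓ <_) c+ℓ≡b (+-monoˡ-< ℓ (<-≤-trans s⊔a<f f≤c))

  lightBlockCost : ∀ {s e f} → s ≤ e → f ≤ e → K * (e ∸ s) ≤ ℓ → K * f ≤ K * (s ⊔ a) + ℓ
  lightBlockCost {s} {e} {f} s≤e f≤e light = begin
    K * f                ≤⟨ *-monoʳ-≤ K f≤e ⟩
    K * e                ≡⟨ cong (K *_) (m+[n∸m]≡n s≤e) ⟨
    K * (s + (e ∸ s))    ≡⟨ *-distribˡ-+ K s (e ∸ s) ⟩
    K * s + K * (e ∸ s)  ≤⟨ +-mono-≤ (*-monoʳ-≤ K (m≤m⊔n s a)) light ⟩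
    K * (s ⊔ a) + ℓ      ∎
    where open ≤-Reasoning

  closeBlock : ∀ {s e f t} → MaximalBlock s e → f ≤ e → f ≤ c → Collected s s t t →
               Conclusion ⊎ Collected (suc e) f t (suc t)
  closeBlock {s} {e} {f} blk f≤e f≤c col with f ≤? s ⊔ a | ℓ ≤? e ∸ s | ℓ ≤? K * (e ∸ s)
  ... | yes f≤s⊔a | _        | _ =
    inj₂ (discard start≤end (≤-trans (*-monoʳ-≤ K f≤s⊔a) (m≤m+n _ ℓ)) col)
    where open MaximalBlock blk
  ... | no f≰s⊔a  | yes long | _ =
    inj₁ (inj₁ (s , e + ℓ , maximalBlock⇒genRun blk long ,
                meets⇒induces (≰⇒> f≰s⊔a) f≤e f≤c))
  ... | no f≰s⊔a  | no short | yes heavy =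
    inj₂ (collect (maximalBlock⇒MGR {K} blk s<e (<⇒≤ (≰⇒> short)) heavy ,
                   meets⇒induces (≰⇒> f≰s⊔a) f≤e f≤c)
                  (<⇒≤ s<e) f≤e col)
    where
    s<e : s < e
    s<e = ≤-<-trans (m≤m⊔n s a) (<-≤-trans (≰⇒> f≰s⊔a) f≤e)
  ... | no _      | no _     | no light =
    inj₂ (discard start≤end (lightBlockCost start≤end f≤e (<⇒≤ (≰⇒> light))) col)
    where open MaximalBlock blk

  finish : ∀ {s t} → LeftMaximalBlock s (a + ℓ) → t ≤ k → Collected s s t t → Conclusion
  finish blk t≤k col
    with e , c≤e , maxBlk ← rightMaximalEnd (extendBlock blk a+ℓ≤c matchesOn-beyondFirstWindow)
                                            (≤c⇒+ℓ≤1+n ≤-refl)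
    with closeBlock maxBlk c≤e ≤-refl col
  ... | inj₁ done = done
  ... | inj₂ col′ =
    inj₂ (mgrs , unique , induced , quarter≤totalWeight ℓ mgrs (enoughArms t≤k withinBudget))
    where open Collected col′

  -- All mismatches of [a .. c) lie in the first window, so the scan stops at a + ℓ and the
  -- block open there reaches c.
  scan : ∀ r {j s t} → j + r ≡ a + ℓ → LeftMaximalBlock s j → t + mismatchCount j r ≤ k →
         Collected s s t t → Conclusion
  scan zero {j} {s} {t} j+0≡a+ℓ blk count col =
    finish (subst (LeftMaximalBlock s) (trans (sym (+-identityʳ j)) j+0≡a+ℓ) blk)
           (≤-trans (m≤m+n t 0) count) col
  scan (suc r) {j} {s} {t} eq blk count col with matches? j
  ... | yes m = scan r (trans (sym (+-suc j r)) eq) (extendBlock blk (n≤1+n j) (matchesOn-singleton m))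
                  (subst (λ x → t + x ≤ k) (mismatchCount-match r m) count) col
  ... | no ¬m with closeBlock (maximalBlock blk (≤c⇒+ℓ≤1+n j≤c) (inj₂ ¬m)) ≤-refl j≤c col
    where
    j≤c : j ≤ c
    j≤c = ≤-trans (m≤m+n j (suc r)) (≤-trans (≤-reflexive eq) a+ℓ≤c)
  ...   | inj₁ done = done
  ...   | inj₂ col′ =
    scan r (trans (sym (+-suc j r)) eq) (startAfterMismatch ¬m)
         (subst (_≤ k) (+-suc t _) (subst (λ x → t + x ≤ k) (mismatchCount-mismatch r ¬m) count))
         (passMismatch col′)

lemma11 : {A : Set} (_≟_ : DecidableEquality A) (n : ℕ) (T : Fin n → A)
          (k ℓ : ℕ) .{{_ : NonZero ℓ}} → 4 * k ≤ ℓ → (a b : ℕ) →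
          UniformRun _≟_ T k ℓ a b →
          (∃[ x ] ∃[ y ] (GenRun T x y ℓ × Induces x y ℓ a b))
          ⊎ (∃[ rs ] (Unique rs
              × All (λ r → MGR T (2 * k + 2) ℓ (proj₁ r) (proj₂ r)
                           × Induces (proj₁ r) (proj₂ r) ℓ a b) rs
              × ((+ 1) / 4) ≤ℚ totalWeight ℓ rs))
lemma11 _≟_ _ T k ℓ 4k≤ℓ a b run@(1≤a , _ , _ , fewMismatches , _)
  = let s , blk = leftMaximalStart a 1≤a
    in scan ℓ refl blk (fewMismatches a ≤-refl a+2ℓ≤b)
            (nothingCollected (LeftMaximalBlock.start≤end blk))
  where
  open Blocks _≟_ T ℓ
  open UniformRunScan _≟_ T 4k≤ℓ run
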